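{- Given natural numbers $N,K,m$, $k\in[1,K]$ and $h\in[1,(N-m)K]$ such that $h\not\equiv k\pmod{K}$, $\langle \mathfrak A(N,K),(0,k)\rangle\mathrel{\underline{\leftrightarrow}}^m_K \langle \mathfrak A(N,K),(h,k)\rangle$.
   Context: For natural numbers $n,K$, $|n|_K$ denotes the unique element of $\{1,\dots,K\}$ congruent to $n$ mod $K$; intervals are intervals of natural numbers. $\mathfrak A=\mathfrak A(N,K)$ is the finite preordered model (downset topology, no dynamics) whose points are the pairs $(h,k)$ with $h\in[0,NK]$, $k\in[1,K]$ and either $h=0$ or $k\neq|h|_K$; $(h,k)\preccurlyeq(h',k')$ iff $h\ge h'$; and $(h,k)$ satisfies exactly the variable $p_k$. $\mathrel{\underline{\leftrightarrow}}^m_K$ is the (purely topological) tangled partial bisimulation: $x\mathrel{\underline{\leftrightarrow}}^0_K y$ iff $x,y$ satisfy the same atoms; $x\mathrel{\underline{\leftrightarrow}}^{m+1}_K y$ iff they satisfy the same atoms and (Forth) whenever $j<K$ and $x_1\approx\dots\approx x_j\preccurlyeq x$ there are $y_1\approx\dots\approx y_j\preccurlyeq y$ with $x_i\mathrel{\underline{\leftrightarrow}}^m_K y_i$ for all $i$, and (Back) symmetrically ($\approx$ is mutual $\preccurlyeq$). -}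

module Defs where

open import Data.Nat using (ℕ; zero; suc; _+_; _*_; _≤_; _<_; _≥_; _%_; ∣_-_∣)
open import Data.Fin using (Fin)
open import Data.Product using (Σ; _×_; _,_)
open import Data.Sum using (_⊎_)
open import Relation.Binary.PropositionalEquality using (_≡_; _≢_)
open import Function.Bundles using (_⇔_)

-- |n|_K : the unique element of {1,…,K} congruent to n mod K.
-- (For K = 0 the value is irrelevant: the model 𝔄(N,0) has no points.)
absmod : ℕ → ℕ → ℕ
absmod n zero    = zero
absmod n (suc K) = suc ((n + K) % suc K)

record Point (N K : ℕ) : Set where
  constructor pt
  field
    h     : ℕ
    k     : ℕ
    h≤NK  : h ≤ N * K
    1≤k   : 1 ≤ k
    k≤K   : k ≤ K
    valid : (h ≡ 0) ⊎ (k ≢ absmod h K)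
open Point public

_≼_ : ∀ {N K} → Point N K → Point N K → Set
x ≼ y = h x ≥ h y

_≈_ : ∀ {N K} → Point N K → Point N K → Set
x ≈ y = (x ≼ y) × (y ≼ x)

Sat : ∀ {N K} → Point N K → ℕ → Set
Sat x v = k x ≡ v

SameAtoms : ∀ {N K} → Point N K → Point N K → Set
SameAtoms x y = ∀ v → Sat x v ⇔ Sat y v

-- A j-tuple y₁ ≈ … ≈ yⱼ ≼ z (≈ is an equivalence, so the chain condition
-- is the same as pairwise ≈).
ClusterBelow : ∀ {N K} → (j : ℕ) → (Fin j → Point N K) → Point N K → Set
ClusterBelow j ys z = (∀ i i' → ys i ≈ ys i') × (∀ i → ys i ≼ z)

-- Tangled partial bisimulation ↔^m_K on 𝔄(N,K) (index K of the relation
-- is the K of the model, as in the statement).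
Bisim : ∀ {N} K → ℕ → Point N K → Point N K → Set
Bisim K zero    x y = SameAtoms x y
Bisim K (suc m) x y =
  SameAtoms x y
  × (∀ j → j < K → (xs : Fin j → Point _ K) → ClusterBelow j xs x →
       Σ (Fin j → Point _ K) λ ys → ClusterBelow j ys y × (∀ i → Bisim K m (xs i) (ys i)))
  × (∀ j → j < K → (ys : Fin j → Point _ K) → ClusterBelow j ys y →
       Σ (Fin j → Point _ K) λ xs → ClusterBelow j xs x × (∀ i → Bisim K m (xs i) (ys i)))

module Submission where

-- The theorem is an instance of a monotonicity fact: two
-- points x, y of 𝔄(N,K) with the same atom and h(x) ≤ h(y) ≤ (N-m)K are
-- m-bisimilar.  The fact is
-- proved by induction on m.
--   * Back: a cluster below y has heights ≥ h(y) ≥ h(x), so it is also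
--     below x, and is matched by itself.
--   * Forth: a cluster below x either already lies below y (matched by
--     itself), or it sits at a height h' < h(y).  Then we lift its j < K
--     points, keeping their atoms, to one common height h'' ∈ [h(y), h(y)+K).
--     By pigeonhole some value in [1,K] is not an atom of the cluster, and
--     |n|_K runs through all of [1,K] on K consecutive n, so h'' can be
--     chosen with that residue, making the lifted points legal.  Since
--     h(y) ≤ (N-m-1)K we get h'' ≤ (N-m)K, and the induction hypothesis
--     matches each point with its lift.
-- The file proves the combinatorial facts (pigeonhole, residues), the
-- height bound, the monotonicity lemma, and then the theorem.

open import Defs
open import Data.Nat using (ℕ; _*_; _∸_; _≤_; ∣_-_∣)
open import Data.Nat.Divisibility using (_∣_)
open import Relation.Binary.PropositionalEquality using (_≡_)
open import Relation.Nullary using (¬_)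

open import Data.Nat using (zero; suc; _+_; _<_; _%_; _/_; _≤?_; _≟_; z≤n; s≤s; NonZero)
open import Data.Nat.Properties
open import Data.Nat.DivMod
open import Data.Nat.Tactic.RingSolver using (solve-∀)
open import Data.Fin using (Fin; toℕ) renaming (zero to fzero)
import Data.Fin.Properties as Fin
open import Data.Product using (Σ; ∃; _×_; _,_; proj₁; proj₂)
open import Data.Sum using (inj₂)
open import Relation.Nullary using (yes; no; contradiction)
open import Relation.Unary using (Decidable)
open import Relation.Binary.PropositionalEquality
  using (refl; sym; trans; cong; _≢_; module ≡-Reasoning)
open import Function.Bundles using (mk⇔)

-- If every value were hit, choosing a witness for each would map Fin K
-- into Fin j with j < K injectively, contradicting the library pigeonhole.
missedValue : ∀ {j K} → j < K → (f : Fin j → ℕ) →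
              ∃ λ (r : Fin K) → ∀ i → f i ≢ suc (toℕ r)
missedValue {j} {K} j<K f =
  let (r , notHit) = Fin.¬∀⟶∃¬ K Hit hit? notAllHit in r , λ i e → notHit (i , e)
  where
  Hit : Fin K → Set
  Hit r = ∃ λ i → f i ≡ suc (toℕ r)
  hit? : Decidable Hit
  hit? r = Fin.any? (λ i → f i ≟ suc (toℕ r))
  notAllHit : ¬ (∀ r → Hit r)
  notAllHit hit with Fin.pigeonhole j<K (λ r → proj₁ (hit r))
  ... | r , r' , r<r' , sameWitness =
    Fin.<⇒≢ r<r' (Fin.toℕ-injective (suc-injective
      (trans (sym (proj₂ (hit r))) (trans (cong f sameWitness) (proj₂ (hit r'))))))

[m+n%d]%d≡[m+n]%d : ∀ m n d .{{_ : NonZero d}} → (m + n % d) % d ≡ (m + n) % d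
[m+n%d]%d≡[m+n]%d m n d = begin
  (m + n % d) % d           ≡⟨ %-distribˡ-+ m (n % d) d ⟩
  (m % d + n % d % d) % d   ≡⟨ cong (λ t → (m % d + t) % d) (m%n%n≡m%n n d) ⟩
  (m % d + n % d) % d       ≡⟨ sym (%-distribˡ-+ m n d) ⟩
  (m + n) % d               ∎
  where open ≡-Reasoning

-- Among n, n+1, …, n+K-1 every residue r < K occurs: with c = n mod K take
-- d = (r + (K - c)) mod K, since n + r + (K - c) = r + (1 + n / K)·K.
residueShift : ∀ n r {K} .{{_ : NonZero K}} → r < K →
               ∃ λ d → d < K × (n + d) % K ≡ r
residueShift n r {K} r<K = (r + (K ∸ c)) % K , m%n<n (r + (K ∸ c)) K , hitsR
  where
  c q : ℕ
  c = n % K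
  q = n / K
  rearranged : n + (r + (K ∸ c)) ≡ r + suc q * K
  rearranged = begin
    n + (r + (K ∸ c))             ≡⟨ cong (_+ (r + (K ∸ c))) (m≡m%n+[m/n]*n n K) ⟩
    c + q * K + (r + (K ∸ c))     ≡⟨ shuffle c (q * K) r (K ∸ c) ⟩
    r + ((c + (K ∸ c)) + q * K)   ≡⟨ cong (λ t → r + (t + q * K)) (m+[n∸m]≡n (m%n≤n n K)) ⟩
    r + suc q * K                 ∎
    where
    open ≡-Reasoning
    shuffle : ∀ a b x y → a + b + (x + y) ≡ x + ((a + y) + b)
    shuffle = solve-∀
  hitsR : (n + (r + (K ∸ c)) % K) % K ≡ r
  hitsR = begin
    (n + (r + (K ∸ c)) % K) % K   ≡⟨ [m+n%d]%d≡[m+n]%d n (r + (K ∸ c)) K ⟩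
    (n + (r + (K ∸ c))) % K       ≡⟨ cong (_% K) rearranged ⟩
    (r + suc q * K) % K           ≡⟨ [m+kn]%n≡m%n r (suc q) K ⟩
    r % K                         ≡⟨ m<n⇒m%n≡m r<K ⟩
    r                             ∎
    where open ≡-Reasoning

absmodOnto : ∀ K n (r : Fin K) → ∃ λ d → d < K × absmod (n + d) K ≡ suc (toℕ r)
absmodOnto (suc K') n r with residueShift (n + K') (toℕ r) (Fin.toℕ<n r)
... | d , d<K , hitsR = d , d<K , cong suc (trans (cong (_% suc K') (swap n d K')) hitsR)
  where
  swap : ∀ a b c → a + b + c ≡ a + c + b
  swap = solve-∀

freshHeight : ∀ {j K} → j < K → (f : Fin j → ℕ) (n : ℕ) →
              ∃ λ d → d < K × (∀ i → f i ≢ absmod (n + d) K)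
freshHeight {K = K} j<K f n with missedValue j<K f
... | r , missed with absmodOnto K n r
... | d , d<K , hitsR = d , d<K , λ i e → missed i (trans e hitsR)

-- One more round of the game needs one more block of height K: if a
-- positive height fits below (N-(m+1))K, then that height plus K fits
-- below (N-m)K.
heightBound : ∀ N m K {n} → 0 < n → n ≤ (N ∸ suc m) * K → n + K ≤ (N ∸ m) * K
heightBound zero    m       K 0<n n≤0 = contradiction n≤0 (<⇒≱ 0<n)
heightBound (suc N) zero    K 0<n n≤  = ≤-trans (+-monoˡ-≤ K n≤) (≤-reflexive (+-comm (N * K) K))
heightBound (suc N) (suc m) K 0<n n≤  = heightBound N m K 0<n n≤

module _ {N K : ℕ} where

  sameAtoms : (x y : Point N K) → k x ≡ k y → SameAtoms x y
  sameAtoms _ _ kx≡ky _ = mk⇔ (trans (sym kx≡ky)) (trans kx≡ky)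

  bisimRefl : ∀ m (z : Point N K) → Bisim K m z z
  bisimRefl zero    z = sameAtoms z z refl
  bisimRefl (suc m) z = sameAtoms z z refl
                      , (λ _ _ zs below → zs , below , λ i → bisimRefl m (zs i))
                      , (λ _ _ zs below → zs , below , λ i → bisimRefl m (zs i))

  liftCluster : ∀ {j} (xs : Fin j → Point N K) (a : ℕ) → a ≤ N * K →
                (∀ i → k (xs i) ≢ absmod a K) → Fin j → Point N K
  liftCluster xs a a≤NK fresh i = pt a (k (xs i)) a≤NK (1≤k (xs i)) (k≤K (xs i)) (inj₂ (fresh i))

  upwardBisim : ∀ m (x y : Point N K) → k x ≡ k y → h x ≤ h y → h y ≤ (N ∸ m) * K →
                Bisim K m x y
  upwardBisim zero    x y kx≡ky _ _ = sameAtoms x y kx≡ky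
  upwardBisim (suc m) x y kx≡ky hx≤hy hy≤ = sameAtoms x y kx≡ky , forth , back
    where
    back : ∀ j → j < K → (ys : Fin j → Point N K) → ClusterBelow j ys y →
           Σ (Fin j → Point N K) λ xs → ClusterBelow j xs x × (∀ i → Bisim K m (xs i) (ys i))
    back j _ ys (cluster , below) =
      ys , (cluster , λ i → ≤-trans hx≤hy (below i)) , λ i → bisimRefl m (ys i)

    liftedMatch : ∀ j → suc j < K → (xs : Fin (suc j) → Point N K) → (∀ i i' → xs i ≈ xs i') →
                  h (xs fzero) < h y →
                  Σ (Fin (suc j) → Point N K) λ ys → ClusterBelow (suc j) ys y × (∀ i → Bisim K m (xs i) (ys i))
    liftedMatch j j<K xs cluster h'<hy with freshHeight j<K (λ i → k (xs i)) (h y)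
    ... | d , d<K , fresh =
      liftCluster xs (h y + d) h''≤NK fresh ,
      ((λ _ _ → ≤-refl , ≤-refl) , λ _ → m≤m+n (h y) d) ,
      λ i → upwardBisim m (xs i) _ refl (≤-trans (proj₁ (cluster fzero i)) h'≤h'') h''≤
      where
      h''≤ : h y + d ≤ (N ∸ m) * K
      h''≤ = ≤-trans (+-monoʳ-≤ (h y) (<⇒≤ d<K)) (heightBound N m K (≤-trans (s≤s z≤n) h'<hy) hy≤)
      h''≤NK : h y + d ≤ N * K
      h''≤NK = ≤-trans h''≤ (*-monoˡ-≤ K (m∸n≤m N m))
      h'≤h'' : h (xs fzero) ≤ h y + d
      h'≤h'' = ≤-trans (<⇒≤ h'<hy) (m≤m+n (h y) d)

    forth : ∀ j → j < K → (xs : Fin j → Point N K) → ClusterBelow j xs x →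
            Σ (Fin j → Point N K) λ ys → ClusterBelow j ys y × (∀ i → Bisim K m (xs i) (ys i))
    forth zero    _   xs _ = xs , ((λ ()) , (λ ())) , λ ()
    forth (suc j) j<K xs (cluster , _) with h y ≤? h (xs fzero)
    ... | yes hy≤h' = xs , (cluster , λ i → ≤-trans hy≤h' (proj₂ (cluster fzero i))) , λ i → bisimRefl m (xs i)
    ... | no  hy≰h' = liftedMatch j j<K xs cluster (≰⇒> hy≰h')

mainTheorem2 : (N K m : ℕ) (x y : Point N K) →
    h x ≡ 0 → k y ≡ k x → 1 ≤ h y → h y ≤ (N ∸ m) * K →
    ¬ (K ∣ ∣ h y - k y ∣) →
    Bisim K m x y
mainTheorem2 N K m x y hx≡0 ky≡kx _ hy≤ _ =
  upwardBisim m x y (sym ky≡kx) (≤-trans (≤-reflexive hx≡0) z≤n) hy≤
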